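{- Let $S$ be a string ending with the unique end symbol $\$$ and let $\mathcal{T}(S)$ be its rotation-trie. For every path $p$ from the root to a leaf in $\mathcal{T}(S)$ there is exactly one node $\phi$ on $p$ such that (1) $\phi$ has a unique Weiner link, (2) the ancestors of $\phi$ on $p$ have multiple Weiner links, and (3) every node in the subtree rooted at $\phi$ has a unique Weiner link.
   Context: $\Sigma$ is a finite totally ordered alphabet containing a symbol $\$$ smaller than all other symbols; $S$ is a string of length $n$ over $\Sigma$ whose last character is $\$$ and in which $\$$ occurs nowhere else. The rotation-trie $\mathcal{T}(S)$ is the trie of the $n$ (distinct) rotations $S[i..n]S[1..i-1]$ of $S$, children ordered by lexicographic order of labels; $l(\phi)$ denotes the concatenation of edge labels from the root to $\phi$. For nodes $\phi,\varphi$ and $c\in\Sigma$, $(\phi,\varphi,c)$ is a Weiner link of $\phi$ if $l(\varphi)=c\,l(\phi)$, or $|l(\phi)|=n$ and $l(\varphi)=c\,l(\phi)[1..n-1]$. A Weiner link $(\phi,\varphi,c)$ is unique if $\phi$ has no other Weiner link $(\phi,\psi,d)$ with $\psi\neq\varphi$; $\phi$ has a unique Weiner link if it has a Weiner link that is unique, and has multiple Weiner links if it has Weiner links to at least two distinct nodes. -}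

module Defs where

open import Data.Nat using (ℕ; suc; _<_; _∸_)
open import Data.Fin using (Fin; zero)
open import Data.List using (List; []; _∷_; _++_; length; take; drop)
open import Data.List.Relation.Unary.All using (All)
open import Data.Product using (Σ; ∃; ∃-syntax; _×_; _,_)
open import Data.Sum using (_⊎_)
open import Relation.Binary.PropositionalEquality using (_≡_; _≢_)
open import Relation.Nullary using (¬_)

-- Alphabet: Fin (suc σ), totally ordered by the order of Fin; the end
-- symbol $ is zero, the smallest symbol.
Char : ℕ → Set
Char σ = Fin (suc σ)

$ : ∀ {σ} → Char σ
$ = zero

Str : ℕ → Set
Str σ = List (Char σ)

-- A valid string: S = T $ where $ does not occur in T.
ValidBody : ∀ {σ} → Str σ → Set
ValidBody T = All (λ c → c ≢ $) T

endWith$ : ∀ {σ} → Str σ → Str σ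
endWith$ T = T ++ ($ ∷ [])

Prefix : ∀ {σ} → Str σ → Str σ → Set
Prefix {σ} u w = Σ (Str σ) (λ v → u ++ v ≡ w)

-- the rotation S[i+1..n] S[1..i] (0-based i), for i < n
rot : ∀ {σ} → Str σ → ℕ → Str σ
rot S i = drop i S ++ take i S

IsRotation : ∀ {σ} → Str σ → Str σ → Set
IsRotation S r = ∃[ i ] (i < length S × r ≡ rot S i)

-- Nodes of the rotation-trie T(S), identified with their labels l(φ):
-- the prefixes of rotations of S (the root is the empty label).
IsNode : ∀ {σ} → Str σ → Str σ → Set
IsNode S w = ∃[ r ] (IsRotation S r × Prefix w r)

IsLeaf : ∀ {σ} → Str σ → Str σ → Set
IsLeaf S w = IsNode S w × (∀ c → ¬ IsNode S (w ++ (c ∷ [])))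

WeinerLink : ∀ {σ} → Str σ → Str σ → Str σ → Char σ → Set
WeinerLink S φ ψ c =
  IsNode S φ × IsNode S ψ ×
  (ψ ≡ c ∷ φ ⊎ (length φ ≡ length S × ψ ≡ c ∷ take (length S ∸ 1) φ))

HasUniqueWL : ∀ {σ} → Str σ → Str σ → Set
HasUniqueWL {σ} S φ =
  ∃[ ψ ] ∃[ c ] (WeinerLink S φ ψ c ×
     (∀ (ψ' : Str σ) (d : Char σ) → WeinerLink S φ ψ' d → ψ' ≡ ψ))

HasMultipleWL : ∀ {σ} → Str σ → Str σ → Set
HasMultipleWL S φ =
  ∃[ ψ₁ ] ∃[ ψ₂ ] ∃[ c ] ∃[ d ]
    (WeinerLink S φ ψ₁ c × WeinerLink S φ ψ₂ d × ψ₁ ≢ ψ₂)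

-- The three conditions on a node φ lying on the root-to-leaf path to leaf w
-- (nodes on the path = prefixes of w; ancestors of φ on the path = proper
-- prefixes of φ; subtree of φ = nodes having l(φ) as prefix).
Good : ∀ {σ} → Str σ → Str σ → Set
Good {σ} S φ =
  HasUniqueWL S φ ×
  (∀ (u : Str σ) → Prefix u φ → u ≢ φ → HasMultipleWL S u) ×
  (∀ (x : Str σ) → IsNode S x → Prefix φ x → HasUniqueWL S x)

module Submission where

-- The proof
-- never uses that S ends with a unique $: everything below holds for an
-- arbitrary string S.
--
-- 1. Every node φ has a Weiner link: if r is a rotation with prefix φ,
--    the rotation preceding r supplies one (`hasLink`).
-- 2. A link is determined by its character, so φ has a unique link iff all
--    of its links carry the same character, and otherwise it has multiple
--    links; this is decidable (`classify`, `uniqueWL?`).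
-- 3. Link characters of a node are link characters of its prefixes, hence
--    uniqueness propagates from φ to its whole subtree (`unique-downward`).
-- 4. A leaf w is a rotation; all its links go to rotations c ∷ init w, and
--    rotations are permutations of S, so c is determined (`leaf-unique`).
-- 5. The good node on the path to w is the shortest prefix of w with a
--    unique link (`shortestPrefix`); it is unique because two prefixes of
--    w are comparable and a node cannot have both a unique and multiple
--    Weiner links.

open import Defs
open import Data.Nat using (ℕ; zero; suc; _+_; _≤_; _<_; _∸_; s≤s)
open import Data.Nat.Properties using (≤-refl; ≤-trans; ≤-reflexive; ≤∧≢⇒<; n<1+n; 1+n≢n; <-irrefl)
import Data.Nat.Properties as ℕ
open import Data.Fin using () renaming (_≟_ to _≟ᶜ_)
open import Data.Fin.Properties using (any?)
open import Data.List using (List; []; _∷_; _++_; _∷ʳ_; length; take; drop; filter)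
open import Data.List.Properties
  using (++-assoc; ++-identityʳ; length-++; length-++-≤ˡ; length-++-sucʳ; ≡-dec; ∷-injectiveˡ; ∷-injectiveʳ;
         take++drop≡id; take-all; drop-all; filter-accept; filter-reject)
open import Data.List.Relation.Binary.Permutation.Propositional using (_↭_; ↭-trans; ↭-sym; ↭-reflexive)
open import Data.List.Relation.Binary.Permutation.Propositional.Properties using (++-comm; ↭-length; filter-↭)
open import Data.Product using (∃-syntax; _×_; _,_; proj₁)
open import Data.Sum using (_⊎_; inj₁; inj₂)
open import Data.Empty using (⊥-elim)
open import Function using (_∘_)
open import Relation.Nullary using (¬_; Dec; yes; no)
open import Relation.Nullary.Decidable using (map′; _×-dec_; _⊎-dec_; ¬?)
open import Relation.Binary.Definitions using (DecidableEquality)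
open import Relation.Binary.PropositionalEquality using (_≡_; _≢_; refl; sym; trans; cong; subst; module ≡-Reasoning)

module _ {A : Set} where

  splitAt : ∀ j (xs : List A) → j < length xs →
    ∃[ x ] (drop j xs ≡ x ∷ drop (suc j) xs × take (suc j) xs ≡ take j xs ∷ʳ x)
  splitAt zero    (x ∷ xs) _         = x , refl , refl
  splitAt (suc j) (y ∷ xs) (s≤s j+1<N) with splitAt j xs j+1<N
  ... | x , dropⱼ , takeⱼ = x , dropⱼ , cong (y ∷_) takeⱼ

  take-init : ∀ (u : List A) c → take (length (u ∷ʳ c) ∸ 1) (u ∷ʳ c) ≡ u
  take-init []          c = refl
  take-init (x ∷ [])    c = refl
  take-init (x ∷ y ∷ u) c = cong (x ∷_) (take-init (y ∷ u) c)

  -- Two permutations of each other that share their tail share their head: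
  -- otherwise they would contain different numbers of copies of it.
  ↭-sameTail⇒sameHead : DecidableEquality A → {c d : A} {u : List A} → c ∷ u ↭ d ∷ u → c ≡ d
  ↭-sameTail⇒sameHead _≟_ {c} {d} {u} perm with c ≟ d
  ... | yes c≡d = c≡d
  ... | no c≢d  = ⊥-elim (1+n≢n occurrences)
    where
    open ≡-Reasoning
    occurrences : suc (length (filter (c ≟_) u)) ≡ length (filter (c ≟_) u)
    occurrences = begin
      suc (length (filter (c ≟_) u))  ≡⟨ cong length (sym (filter-accept (c ≟_) refl)) ⟩
      length (filter (c ≟_) (c ∷ u))  ≡⟨ ↭-length (filter-↭ (c ≟_) perm) ⟩
      length (filter (c ≟_) (d ∷ u))  ≡⟨ cong length (filter-reject (c ≟_) c≢d) ⟩
      length (filter (c ≟_) u)        ∎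

module _ {σ : ℕ} where

  prefix-length : {u w : Str σ} → Prefix u w → length u ≤ length w
  prefix-length {u} (v , refl) = length-++-≤ˡ u

  prefix-full : {u w : Str σ} → Prefix u w → length w ≤ length u → u ≡ w
  prefix-full {u} ([]    , refl) _  = sym (++-identityʳ u)
  prefix-full {u} (c ∷ v , refl) le =
    ⊥-elim (<-irrefl refl (≤-trans (s≤s (length-++-≤ˡ u))
                                   (subst (_≤ length u) (length-++-sucʳ u c v) le)))

  prefix-trans : {u v w : Str σ} → Prefix u v → Prefix v w → Prefix u w
  prefix-trans {u} (a , refl) (b , refl) = a ++ b , sym (++-assoc u a b)

  prefix-∷ : {u w : Str σ} (c : Char σ) → Prefix u w → Prefix (c ∷ u) (c ∷ w)
  prefix-∷ c (v , e) = v , cong (c ∷_) e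

  prefix-take : {u w : Str σ} (k : ℕ) → Prefix u w → length u ≤ k → Prefix u (take k w)
  prefix-take {[]}    k       _        _         = take k _ , refl
  prefix-take {x ∷ u} (suc k) (v , refl) (s≤s le) = prefix-∷ x (prefix-take k (v , refl) le)

  prefix-total : {u u' w : Str σ} → Prefix u w → Prefix u' w → Prefix u u' ⊎ Prefix u' u
  prefix-total {[]}    _ _ = inj₁ (_ , refl)
  prefix-total {_ ∷ _} {[]} _ _ = inj₂ (_ , refl)
  prefix-total {x ∷ u} {y ∷ u'} (v , refl) (v' , e) with ∷-injectiveˡ e
  ... | refl with prefix-total (v , refl) (v' , ∷-injectiveʳ e)
  ...   | inj₁ u⊑u' = inj₁ (prefix-∷ x u⊑u')
  ...   | inj₂ u'⊑u = inj₂ (prefix-∷ x u'⊑u)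

  prefix? : (u w : Str σ) → Dec (Prefix u w)
  prefix? []      w       = yes (w , refl)
  prefix? (x ∷ u) []      = no λ ()
  prefix? (x ∷ u) (y ∷ w) with x ≟ᶜ y | prefix? u w
  ... | no x≢y   | _            = no λ (v , e) → x≢y (∷-injectiveˡ e)
  ... | yes refl | yes (v , e)  = yes (v , cong (x ∷_) e)
  ... | yes refl | no u⋢w       = no λ (v , e) → u⋢w (v , ∷-injectiveʳ e)

  shortestPrefix : (P : Str σ → Set) → (∀ u → Dec (P u)) → (w : Str σ) → P w →
    ∃[ φ ] (Prefix φ w × P φ × (∀ u → Prefix u φ → u ≢ φ → ¬ P u))
  shortestPrefix P P? w Pw with P? []
  ... | yes P[] = [] , (w , refl) , P[] , λ { [] _ []≢[] _ → []≢[] refl ; (_ ∷ _) (_ , ()) }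
  shortestPrefix P P? [] Pw | no ¬P[] = ⊥-elim (¬P[] Pw)
  shortestPrefix P P? (c ∷ w) Pw | no ¬P[]
    with shortestPrefix (P ∘ (c ∷_)) (P? ∘ (c ∷_)) w Pw
  ... | φ , φ⊑w , Pcφ , shortest = c ∷ φ , prefix-∷ c φ⊑w , Pcφ , earlier
    where
    earlier : ∀ u → Prefix u (c ∷ φ) → u ≢ c ∷ φ → ¬ P u
    earlier []      _       _  = ¬P[]
    earlier (d ∷ u) (v , e) ne with ∷-injectiveˡ e
    ... | refl = shortest u (v , ∷-injectiveʳ e) (ne ∘ cong (c ∷_))

  rotation↭ : {S r : Str σ} → IsRotation S r → r ↭ S
  rotation↭ {S} (i , _ , refl) =
    ↭-trans (++-comm (drop i S) (take i S)) (↭-reflexive (take++drop≡id i S))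

  rotation-length : {S r : Str σ} → IsRotation S r → length r ≡ length S
  rotation-length = ↭-length ∘ rotation↭

  -- Every rotation r = u c is preceded by the rotation c u: the predecessor of
  -- rot S (j + 1) is rot S j, and that of rot S 0 is rot S (|S| - 1).
  predecessor : (S : Str σ) {r : Str σ} → IsRotation S r →
    ∃[ c ] ∃[ u ] (r ≡ u ∷ʳ c × IsRotation S (c ∷ u))
  predecessor (y ∷ ys) (zero , _ , refl)
    with splitAt (length ys) (y ∷ ys) ≤-refl
  ... | x , dropₙ , takeₙ = x , take n S , rot₀ , n , n<1+n n , sym rotₙ
    where
    S = y ∷ ys
    n = length ys
    open ≡-Reasoning
    rot₀ : S ++ [] ≡ take n S ∷ʳ x
    rot₀ = begin
      S ++ []           ≡⟨ ++-identityʳ S ⟩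
      S                 ≡⟨ take-all (suc n) S ≤-refl ⟨
      take (suc n) S    ≡⟨ takeₙ ⟩
      take n S ∷ʳ x     ∎
    rotₙ : rot S n ≡ x ∷ take n S
    rotₙ = cong (_++ take n S) (trans dropₙ (cong (x ∷_) (drop-all (suc n) S ≤-refl)))
  predecessor S (suc j , j+1<N , refl) with splitAt j S (ℕ.<⇒≤ j+1<N)
  ... | x , dropⱼ , takeⱼ =
      x , drop (suc j) S ++ take j S , rotⱼ₊₁ , j , ℕ.<⇒≤ j+1<N , sym (cong (_++ take j S) dropⱼ)
    where
    rotⱼ₊₁ : rot S (suc j) ≡ (drop (suc j) S ++ take j S) ∷ʳ x
    rotⱼ₊₁ = trans (cong (drop (suc j) S ++_) takeⱼ)
                   (sym (++-assoc (drop (suc j) S) (take j S) (x ∷ [])))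

module RotationTrie {σ : ℕ} (S : Str σ) where

  N : ℕ
  N = length S

  rotation-node : {r : Str σ} → IsRotation S r → IsNode S r
  rotation-node {r} rotᵣ = r , rotᵣ , [] , ++-identityʳ r

  prefix-node : {u x : Str σ} → Prefix u x → IsNode S x → IsNode S u
  prefix-node u⊑x (r , rotᵣ , x⊑r) = r , rotᵣ , prefix-trans u⊑x x⊑r

  node-length : {x : Str σ} → IsNode S x → length x ≤ N
  node-length (r , rotᵣ , x⊑r) = subst (_ ≤_) (rotation-length rotᵣ) (prefix-length x⊑r)

  fullNode⇒rotation : {x : Str σ} → IsNode S x → N ≤ length x → IsRotation S x
  fullNode⇒rotation (r , rotᵣ , x⊑r) N≤ =
    subst (IsRotation S) (sym (prefix-full x⊑r (subst (_≤ _) (sym (rotation-length rotᵣ)) N≤))) rotᵣ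

  rotation-init : {r u : Str σ} {c : Char σ} → IsRotation S r → r ≡ u ∷ʳ c → take (N ∸ 1) r ≡ u
  rotation-init {u = u} {c} rotᵣ refl =
    trans (cong (λ k → take (k ∸ 1) (u ∷ʳ c)) (sym (rotation-length rotᵣ))) (take-init u c)

  -- Being a node is decidable: only the N rotations rot S i, i < N, need checking.
  node? : (w : Str σ) → Dec (IsNode S w)
  node? w = map′ (λ (i , i<N , w⊑) → rot S i , (i , i<N , refl) , w⊑)
                 (λ { (_ , (i , i<N , refl) , w⊑) → i , i<N , w⊑ })
                 (ℕ.anyUpTo? (λ i → prefix? w (rot S i)) N)

  WL : Str σ → Str σ → Char σ → Set
  WL = WeinerLink S

  LinkChar : Str σ → Char σ → Set
  LinkChar φ c = ∃[ ψ ] WL φ ψ c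

  link-source : {φ ψ : Str σ} {c : Char σ} → WL φ ψ c → IsNode S φ
  link-source = proj₁

  link-head : {φ ψ : Str σ} {c : Char σ} → WL φ ψ c → ∃[ t ] (ψ ≡ c ∷ t)
  link-head (_ , _ , inj₁ refl)       = _ , refl
  link-head (_ , _ , inj₂ (_ , refl)) = _ , refl

  no-longer-node : {φ : Str σ} (c : Char σ) → length φ ≡ N → ¬ IsNode S (c ∷ φ)
  no-longer-node c len node = <-irrefl refl (subst (λ k → suc k ≤ N) len (node-length node))

  link-determined : {φ ψ ψ' : Str σ} {c : Char σ} → WL φ ψ c → WL φ ψ' c → ψ ≡ ψ'
  link-determined (_ , _ , inj₁ refl)       (_ , _ , inj₁ refl)       = refl
  link-determined (_ , n , inj₁ refl)       (_ , _ , inj₂ (len , _))  = ⊥-elim (no-longer-node _ len n)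
  link-determined (_ , _ , inj₂ (len , _))  (_ , n , inj₁ refl)       = ⊥-elim (no-longer-node _ len n)
  link-determined (_ , _ , inj₂ (_ , refl)) (_ , _ , inj₂ (_ , refl)) = refl

  linkChar? : (φ : Str σ) (c : Char σ) → Dec (LinkChar φ c)
  linkChar? φ c = map′ toLink fromLink
    (node? φ ×-dec (node? (c ∷ φ) ⊎-dec ((length φ ℕ.≟ N) ×-dec node? (c ∷ take (N ∸ 1) φ))))
    where
    toLink : _ → LinkChar φ c
    toLink (nφ , inj₁ n)         = c ∷ φ , nφ , n , inj₁ refl
    toLink (nφ , inj₂ (len , n)) = _ , nφ , n , inj₂ (len , refl)
    fromLink : LinkChar φ c → _
    fromLink (_ , nφ , n , inj₁ refl)         = nφ , inj₁ n
    fromLink (_ , nφ , n , inj₂ (len , refl)) = nφ , inj₂ (len , n)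

  -- Every node has a Weiner link, towards the rotation preceding any
  -- rotation it is a prefix of.
  hasLink : {φ : Str σ} → IsNode S φ → ∃[ ψ ] ∃[ c ] WL φ ψ c
  hasLink {φ} nφ@(r , rotᵣ , φ⊑r) with predecessor S rotᵣ
  ... | c , u , r≡uc , rot-cu with length φ ℕ.≟ N
  ...   | yes len = c ∷ take (N ∸ 1) φ , c , nφ , target , inj₂ (len , refl)
    where
    φ≡r : φ ≡ r
    φ≡r = prefix-full φ⊑r (≤-reflexive (trans (rotation-length rotᵣ) (sym len)))
    init≡u : take (N ∸ 1) φ ≡ u
    init≡u = trans (cong (take (N ∸ 1)) φ≡r) (rotation-init rotᵣ r≡uc)
    target : IsNode S (c ∷ take (N ∸ 1) φ)
    target = subst (λ v → IsNode S (c ∷ v)) (sym init≡u) (rotation-node rot-cu)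
  ...   | no ¬len = c ∷ φ , c , nφ , prefix-node (prefix-∷ c φ⊑u) (rotation-node rot-cu) , inj₁ refl
    where
    φ⊑u : Prefix φ u
    φ⊑u = subst (Prefix φ) (rotation-init rotᵣ r≡uc)
            (prefix-take (N ∸ 1) φ⊑r (ℕ.<⇒≤pred (≤∧≢⇒< (node-length nφ) ¬len)))

  linkChar-prefix : {φ x : Str σ} {d : Char σ} → Prefix φ x → LinkChar x d → LinkChar φ d
  linkChar-prefix {φ} {x} {d} φ⊑x (ψ , nx , nψ , target) with length φ ℕ.≟ N
  ... | yes len = subst (λ y → LinkChar y d) (sym φ≡x) (ψ , nx , nψ , target)
    where
    φ≡x : φ ≡ x
    φ≡x = prefix-full φ⊑x (subst (length x ≤_) (sym len) (node-length nx))
  ... | no ¬len = d ∷ φ , prefix-node φ⊑x nx , prefix-node (dφ⊑ψ target) nψ , inj₁ refl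
    where
    short : length φ ≤ N ∸ 1
    short = ℕ.<⇒≤pred (≤∧≢⇒< (≤-trans (prefix-length φ⊑x) (node-length nx)) ¬len)
    dφ⊑ψ : ψ ≡ d ∷ x ⊎ (length x ≡ N × ψ ≡ d ∷ take (N ∸ 1) x) → Prefix (d ∷ φ) ψ
    dφ⊑ψ (inj₁ refl)       = prefix-∷ d φ⊑x
    dφ⊑ψ (inj₂ (_ , refl)) = prefix-∷ d (prefix-take (N ∸ 1) φ⊑x short)

  SingleLinkChar : Str σ → Set
  SingleLinkChar φ = ∀ {ψ ψ' c d} → WL φ ψ c → WL φ ψ' d → c ≡ d

  -- A unique Weiner link means a single link character, and conversely for nodes
  -- (which always have some link); two characters give two distinct targets.
  unique⇒single : {φ : Str σ} → HasUniqueWL S φ → SingleLinkChar φ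
  unique⇒single (_ , _ , _ , onlyψ₀) l l'
    with link-head l | link-head l' | trans (onlyψ₀ _ _ l) (sym (onlyψ₀ _ _ l'))
  ... | _ , refl | _ , refl | same = ∷-injectiveˡ same

  single⇒unique : {φ : Str σ} → IsNode S φ → SingleLinkChar φ → HasUniqueWL S φ
  single⇒unique nφ single with hasLink nφ
  ... | ψ , c , l = ψ , c , l , λ ψ' d l' → link-determined (subst (WL _ ψ') (single l' l) l') l

  twoChars⇒multiple : {φ ψ ψ' : Str σ} {c d : Char σ} → WL φ ψ c → WL φ ψ' d → c ≢ d → HasMultipleWL S φ
  twoChars⇒multiple l l' c≢d with link-head l | link-head l'
  ... | _ , refl | _ , refl = _ , _ , _ , _ , l , l' , c≢d ∘ ∷-injectiveˡ

  unique-not-multiple : {φ : Str σ} → HasUniqueWL S φ → ¬ HasMultipleWL S φ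
  unique-not-multiple (_ , _ , _ , onlyψ) (_ , _ , _ , _ , l₁ , l₂ , ψ₁≢ψ₂) =
    ψ₁≢ψ₂ (trans (onlyψ _ _ l₁) (sym (onlyψ _ _ l₂)))

  classify : {φ : Str σ} → IsNode S φ → HasMultipleWL S φ ⊎ HasUniqueWL S φ
  classify {φ} nφ with hasLink nφ
  ... | _ , c₀ , l₀ with any? (λ d → ¬? (d ≟ᶜ c₀) ×-dec linkChar? φ d)
  ...   | yes (d , d≢c₀ , _ , l) = inj₁ (twoChars⇒multiple l l₀ d≢c₀)
  ...   | no none = inj₂ (single⇒unique nφ λ l l' → trans (isC₀ l) (sym (isC₀ l')))
    where
    isC₀ : ∀ {ψ c} → WL φ ψ c → c ≡ c₀
    isC₀ {c = c} l with c ≟ᶜ c₀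
    ... | yes c≡c₀ = c≡c₀
    ... | no c≢c₀  = ⊥-elim (none (c , c≢c₀ , _ , l))

  uniqueWL? : (φ : Str σ) → Dec (HasUniqueWL S φ)
  uniqueWL? φ with node? φ
  ... | no ¬node = no λ (_ , _ , l , _) → ¬node (link-source l)
  ... | yes nφ with classify nφ
  ...   | inj₁ multiple = no λ unique → unique-not-multiple unique multiple
  ...   | inj₂ unique   = yes unique

  unique-downward : {φ x : Str σ} → HasUniqueWL S φ → IsNode S x → Prefix φ x → HasUniqueWL S x
  unique-downward uφ nx φ⊑x = single⇒unique nx λ l l' →
    let (_ , lφ) = linkChar-prefix φ⊑x (_ , l)
        (_ , lφ') = linkChar-prefix φ⊑x (_ , l')
    in unique⇒single uφ lφ lφ'

  leaf⇒rotation : {w : Str σ} → IsLeaf S w → IsRotation S w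
  leaf⇒rotation ((r , rotᵣ , [] , w≡r) , _) = subst (IsRotation S) (trans (sym w≡r) (++-identityʳ _)) rotᵣ
  leaf⇒rotation ((r , rotᵣ , c ∷ v , w≡r) , childless) =
    ⊥-elim (childless c (r , rotᵣ , v , trans (++-assoc _ (c ∷ []) v) w≡r))

  rotation-link : {w u ψ : Str σ} {e c : Char σ} → IsRotation S w → w ≡ u ∷ʳ e → WL w ψ c → c ∷ u ↭ S
  rotation-link rot-w _ (_ , nψ , inj₁ refl) = ⊥-elim (no-longer-node _ (rotation-length rot-w) nψ)
  rotation-link {w} {u} {e = e} {c} rot-w w≡ue (_ , nψ , inj₂ (_ , refl)) =
    rotation↭ (fullNode⇒rotation nψ' (≤-reflexive full))
    where
    init≡u : take (N ∸ 1) w ≡ u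
    init≡u = rotation-init rot-w w≡ue
    nψ' : IsNode S (c ∷ u)
    nψ' = subst (λ v → IsNode S (c ∷ v)) init≡u nψ
    full : N ≡ suc (length u)
    full = begin
      N                   ≡⟨ rotation-length rot-w ⟨
      length w            ≡⟨ cong length w≡ue ⟩
      length (u ∷ʳ e)     ≡⟨ length-++ u ⟩
      length u + 1        ≡⟨ ℕ.+-comm (length u) 1 ⟩
      suc (length u)      ∎
      where open ≡-Reasoning

  -- Leaves have a unique Weiner link: the rotations c u and d u are permutations
  -- of each other, hence c ≡ d.
  leaf-unique : {w : Str σ} → IsLeaf S w → HasUniqueWL S w
  leaf-unique leaf with leaf⇒rotation leaf
  ... | rot-w with predecessor S rot-w
  ...   | _ , _ , w≡ue , _ = single⇒unique (proj₁ leaf) λ l l' →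
            ↭-sameTail⇒sameHead _≟ᶜ_
              (↭-trans (rotation-link rot-w w≡ue l) (↭-sym (rotation-link rot-w w≡ue l')))

  goodOnPath : {w : Str σ} → IsLeaf S w → ∃[ φ ] (Prefix φ w × Good S φ)
  goodOnPath {w} leaf with shortestPrefix (HasUniqueWL S) uniqueWL? w (leaf-unique leaf)
  ... | φ , φ⊑w , uφ@(_ , _ , lφ , _) , shortest =
      φ , φ⊑w , uφ , ancestors , λ x nx φ⊑x → unique-downward uφ nx φ⊑x
    where
    ancestors : ∀ u → Prefix u φ → u ≢ φ → HasMultipleWL S u
    ancestors u u⊑φ u≢φ with classify (prefix-node u⊑φ (link-source lφ))
    ... | inj₁ multiple = multiple
    ... | inj₂ unique   = ⊥-elim (shortest u u⊑φ u≢φ unique)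

  -- Two good prefixes of the same string coincide: otherwise the shorter is
  -- a proper ancestor of the longer, so it has both kinds of Weiner links.
  good-unique : {w φ φ' : Str σ} → Prefix φ w → Good S φ → Prefix φ' w → Good S φ' → φ' ≡ φ
  good-unique {φ = φ} {φ'} φ⊑w (uφ , ancestorsφ , _) φ'⊑w (uφ' , ancestorsφ' , _) with ≡-dec _≟ᶜ_ φ' φ
  ... | yes φ'≡φ = φ'≡φ
  ... | no φ'≢φ with prefix-total φ⊑w φ'⊑w
  ...   | inj₁ φ⊑φ' = ⊥-elim (unique-not-multiple uφ (ancestorsφ' φ φ⊑φ' (φ'≢φ ∘ sym)))
  ...   | inj₂ φ'⊑φ = ⊥-elim (unique-not-multiple uφ' (ancestorsφ φ' φ'⊑φ φ'≢φ))

lemma4 : (σ : ℕ) (T : Str σ) → ValidBody T →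
    (w : Str σ) → IsLeaf (endWith$ T) w →
    ∃[ φ ] ((Prefix φ w × Good (endWith$ T) φ) ×
      (∀ (φ' : Str σ) → Prefix φ' w → Good (endWith$ T) φ' → φ' ≡ φ))
lemma4 σ T _ w leaf =
  let (φ , φ⊑w , good) = goodOnPath leaf
  in φ , (φ⊑w , good) , λ φ' φ'⊑w good' → good-unique φ⊑w good φ'⊑w good'
  where open RotationTrie (endWith$ T)
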